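{- Let $A=\{12,14,16,18\}$. For every $k\in A$, every positive integer $m'$ and every non-negative integer $n'$, $\lambda_1^1(C_{10m'} \times C_{k+10n'})=5$.
   Context: For a graph $G$, an $L(1,1)$-labeling with labels in $\{0,1,\dots,p\}$ is a function $l:V(G)\to\{0,1,\dots,p\}$ such that $l(u)\neq l(v)$ whenever the distance $d(u,v)$ is $1$ or $2$. $\lambda_1^1(G)$ denotes the least $p$ for which $G$ admits such a labeling. $C_n$ denotes the cycle with $n$ vertices. The direct product $G\times H$ has vertex set $V(G)\times V(H)$, with $(x_1,x_2)$ adjacent to $(y_1,y_2)$ iff $x_1y_1\in E(G)$ and $x_2y_2\in E(H)$. -}

module Defs where

open import Data.Nat using (ℕ; suc; _+_; _*_; _<_)
open import Data.Fin using (Fin; toℕ)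
open import Data.Product using (_×_; ∃)
open import Data.Sum using (_⊎_)
open import Relation.Binary.PropositionalEquality using (_≡_; _≢_)
open import Relation.Nullary using (¬_)

record Graph : Set₁ where
  field
    V   : Set
    Adj : V → V → Set
open Graph public

-- Cycle C_n on vertices 0..n-1: i ~ j iff j = i+1 (mod n) or i = j+1 (mod n).
-- (Used only for n ≥ 3, where this is the usual cycle.)
CycStep : (n : ℕ) → Fin n → Fin n → Set
CycStep n i j = (suc (toℕ i) ≡ toℕ j) ⊎ ((suc (toℕ i) ≡ n) × (toℕ j ≡ 0))

Cycle : ℕ → Graph
Cycle n = record { V = Fin n ; Adj = λ i j → CycStep n i j ⊎ CycStep n j i }

_×ᴳ_ : Graph → Graph → Graph
G ×ᴳ H = record
  { V   = V G × V H
  ; Adj = λ x y → Adj G (Data.Product.proj₁ x) (Data.Product.proj₁ y)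
                × Adj H (Data.Product.proj₂ x) (Data.Product.proj₂ y)
  }

Dist12 : (G : Graph) → V G → V G → Set
Dist12 G u v = (u ≢ v) × (Adj G u v ⊎ ∃ λ w → Adj G u w × Adj G w v)

IsL11Labeling : (G : Graph) (p : ℕ) → (V G → Fin (suc p)) → Set
IsL11Labeling G p l = ∀ u v → Dist12 G u v → l u ≢ l v

HasL11 : Graph → ℕ → Set
HasL11 G p = ∃ λ (l : V G → Fin (suc p)) → IsL11Labeling G p l

λ11≡ : Graph → ℕ → Set
λ11≡ G p = HasL11 G p × (∀ q → q < p → ¬ HasL11 G q)

-- Under (a, b) ↦ (a + b, a − b) the square grid ℤ² maps into C_M × C_N,
-- grid neighbours going to torus neighbours, so an L(1,1)-labelling of the torus pulls
-- back to one of ℤ², in which every closed neighbourhood (five vertices) is rainbow.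
-- With only five labels a local case analysis makes the labels 5-periodic along rows
-- and columns, and along the antidiagonal t ↦ (t, −t) the label recurs exactly at the
-- multiples of 5. As (h, −h) is sent to the origin when N = 2h, five labels are
-- impossible for N ≡ 2, 4, 6, 8 (mod 10).
--
-- Six labels suffice: the label of (i, j) is read off a table at column
-- i mod 10 and at a row state, the rows of C_N running once through a block of k rows
-- and then n′ times through a fixed block of ten. Whether this is an L(1,1)-labelling
-- only depends on pairs and triples of consecutive row states, which are checked by
-- evaluation.

module Submission where

open import Defs
open import Data.Empty using (⊥)
open import Data.Fin as Fin using (Fin; toℕ; opposite; inject≤; #_)
open import Data.Fin.Properties as Fin
  using (_≟_; toℕ<n; toℕ-fromℕ<; toℕ-injective; opposite-prop; injective⇒≤; inject≤-injective)
open import Data.Integer using (ℤ; +_; -[1+_]; 0ℤ; 1ℤ; -1ℤ; _+_; _-_; -_) renaming (suc to sucℤ)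
open import Data.Integer.Properties
  using (+-identityˡ; +-comm; +-commutativeSemigroup; neg-distrib-+; +-inverseʳ; neg-involutive)
open import Algebra.Properties.CommutativeSemigroup +-commutativeSemigroup using (xy∙z≈xz∙y)
open import Data.Integer.Tactic.RingSolver using (solve-∀)
open import Data.List using (List; []; _∷_)
open import Data.List.Membership.Propositional using () renaming (_∈_ to _∈ₗ_)
open import Data.List.Relation.Unary.Any using (here; there)
import Data.List.Relation.Unary.All as List
open import Data.Nat as ℕ using (ℕ; zero; suc; NonZero; _≤_; _<_; _%_; s≤s; z≤n)
open import Data.Nat.DivMod
  using (_mod_; m%n<n; n%n≡0; m<n⇒m%n≡m; %-distribˡ-+; m%n%n≡m%n; m≡m%n+[m/n]*n; m∣n⇒o%n%m≡o%m; [m+kn]%n≡m%n)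
open import Data.Nat.Divisibility using (_∣_; n∣m⇒m%n≡0; ∣-reflexive; m∣m*n)
import Data.Nat.Properties as ℕ
import Data.Nat.Tactic.RingSolver as ℕ
open import Data.Product using (_×_; _,_; proj₁; proj₂)
open import Data.Sum using (_⊎_; inj₁; inj₂; [_,_])
open import Data.Vec using (Vec; []; _∷_; lookup)
open import Data.Vec.Membership.Propositional using (_∈_)
open import Data.Vec.Relation.Unary.All using (All; []; _∷_)
open import Data.Vec.Relation.Unary.AllPairs using ([]; _∷_)
open import Data.Vec.Relation.Unary.Any using (here; there; any?)
open import Data.Vec.Relation.Unary.Unique.Propositional using (Unique)
open import Data.Vec.Relation.Unary.Unique.Propositional.Properties using (lookup-injective)
open import Function using (_∘_)
open import Relation.Binary.Definitions using (tri<; tri≈; tri>)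
open import Relation.Binary.PropositionalEquality hiding ([_])
open import Relation.Nullary using (¬_; Dec; yes; no; contradiction; ¬?; _×-dec_)
import Relation.Nullary.Decidable as Dec

module _ {n : ℕ} .{{_ : NonZero n}} where

  cycleSucc : Fin n → Fin n
  cycleSucc i = suc (toℕ i) mod n

  toℕ-mod : ∀ m → toℕ (m mod n) ≡ m % n
  toℕ-mod m = toℕ-fromℕ< (m%n<n m n)

  toℕ-0mod : toℕ (0 mod n) ≡ 0
  toℕ-0mod = trans (toℕ-mod 0) (m<n⇒m%n≡m (ℕ.>-nonZero⁻¹ n))

  mod-cong : ∀ {m m′} → m % n ≡ m′ % n → m mod n ≡ m′ mod n
  mod-cong e = toℕ-injective (trans (toℕ-mod _) (trans e (sym (toℕ-mod _))))

  cycStep-cycleSucc : ∀ i → CycStep n i (cycleSucc i)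
  cycStep-cycleSucc i with ℕ.m≤n⇒m<n∨m≡n (toℕ<n i)
  ... | inj₁ i+1<n = inj₁ (sym (trans (toℕ-mod (suc (toℕ i))) (m<n⇒m%n≡m i+1<n)))
  ... | inj₂ i+1≡n = inj₂ (i+1≡n , trans (toℕ-mod (suc (toℕ i))) (trans (cong (_% n) i+1≡n) (n%n≡0 n)))

  cycStep⇒≡cycleSucc : ∀ {i j} → CycStep n i j → j ≡ cycleSucc i
  cycStep⇒≡cycleSucc {i} {j} (inj₁ i+1≡j) = toℕ-injective (begin
    toℕ j              ≡⟨ sym (m<n⇒m%n≡m (toℕ<n j)) ⟩
    toℕ j % n          ≡⟨ cong (_% n) (sym i+1≡j) ⟩
    suc (toℕ i) % n    ≡⟨ sym (toℕ-mod (suc (toℕ i))) ⟩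
    toℕ (cycleSucc i)  ∎)
    where open ≡-Reasoning
  cycStep⇒≡cycleSucc {i} {j} (inj₂ (i+1≡n , j≡0)) = toℕ-injective (begin
    toℕ j              ≡⟨ j≡0 ⟩
    0                  ≡⟨ sym (n%n≡0 n) ⟩
    n % n              ≡⟨ cong (_% n) (sym i+1≡n) ⟩
    suc (toℕ i) % n    ≡⟨ sym (toℕ-mod (suc (toℕ i))) ⟩
    toℕ (cycleSucc i)  ∎)
    where open ≡-Reasoning

  cycleSucc-mod : ∀ m → cycleSucc (m mod n) ≡ suc m mod n
  cycleSucc-mod m = toℕ-injective (begin
    toℕ (cycleSucc (m mod n))     ≡⟨ toℕ-mod _ ⟩
    suc (toℕ (m mod n)) % n       ≡⟨ cong (λ r → suc r % n) (toℕ-mod m) ⟩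
    (1 ℕ.+ m % n) % n             ≡⟨ %-distribˡ-+ 1 (m % n) n ⟩
    (1 % n ℕ.+ m % n % n) % n     ≡⟨ cong (λ r → (1 % n ℕ.+ r) % n) (m%n%n≡m%n m n) ⟩
    (1 % n ℕ.+ m % n) % n         ≡⟨ sym (%-distribˡ-+ 1 m n) ⟩
    suc m % n                     ≡⟨ sym (toℕ-mod (suc m)) ⟩
    toℕ (suc m mod n)             ∎)
    where open ≡-Reasoning

cycleSucc-mod≡zero : ∀ {n₀ m} → suc n₀ ∣ suc m → cycleSucc (m mod suc n₀) ≡ Fin.zero
cycleSucc-mod≡zero {n₀} {m} n∣m+1 =
  trans (cycleSucc-mod m) (toℕ-injective (trans (toℕ-mod (suc m)) (n∣m⇒m%n≡0 (suc m) (suc n₀) n∣m+1)))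

cycStep-opposite : ∀ {n} {i j : Fin n} → CycStep n i j → CycStep n (opposite j) (opposite i)
cycStep-opposite {suc n} {i} {j} (inj₁ i+1≡j) = inj₁ (begin
  suc (toℕ (opposite j))  ≡⟨ cong suc (opposite-prop j) ⟩
  suc (n ℕ.∸ toℕ j)       ≡⟨ cong (λ t → suc (n ℕ.∸ t)) (sym i+1≡j) ⟩
  suc (n ℕ.∸ suc (toℕ i)) ≡⟨ sym (ℕ.+-∸-assoc 1 (subst (_≤ n) (sym i+1≡j) (ℕ.s≤s⁻¹ (toℕ<n j)))) ⟩
  n ℕ.∸ toℕ i             ≡⟨ sym (opposite-prop i) ⟩
  toℕ (opposite i)        ∎)
  where open ≡-Reasoning
cycStep-opposite {suc n} {i} {j} (inj₂ (i+1≡n , j≡0)) = inj₂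
  ( cong suc (trans (opposite-prop j) (cong (n ℕ.∸_) j≡0))
  , trans (opposite-prop i) (trans (cong (n ℕ.∸_) (ℕ.suc-injective i+1≡n)) (ℕ.n∸n≡0 n)) )

cycStep-irrefl : ∀ {n} → 2 ≤ n → {i j : Fin n} → CycStep n i j → i ≢ j
cycStep-irrefl _   (inj₁ i+1≡i)         refl = ℕ.1+n≢n i+1≡i
cycStep-irrefl 2≤n (inj₂ (i+1≡n , i≡0)) refl = ℕ.<⇒≢ 2≤n (trans (cong suc (sym i≡0)) i+1≡n)

cycStep²-irrefl : ∀ {n} → 3 ≤ n → {i j k : Fin n} → CycStep n i j → CycStep n j k → i ≢ k
cycStep²-irrefl _ (inj₁ i+1≡j) (inj₁ j+1≡i) refl =
  ℕ.<-asym (ℕ.≤-reflexive i+1≡j) (ℕ.≤-reflexive j+1≡i)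
cycStep²-irrefl 3≤n (inj₁ i+1≡j) (inj₂ (j+1≡n , i≡0)) refl =
  ℕ.<⇒≢ 3≤n (trans (cong (suc ∘ suc) (sym i≡0)) (trans (cong suc i+1≡j) j+1≡n))
cycStep²-irrefl 3≤n (inj₂ (i+1≡n , j≡0)) (inj₁ j+1≡i) refl =
  ℕ.<⇒≢ 3≤n (trans (cong (suc ∘ suc) (sym j≡0)) (trans (cong suc j+1≡i) i+1≡n))
cycStep²-irrefl 3≤n (inj₂ (_ , j≡0)) (inj₂ (j+1≡n , _)) refl =
  ℕ.<⇒≢ (ℕ.<-trans (s≤s (s≤s z≤n)) 3≤n) (trans (cong suc (sym j≡0)) j+1≡n)

cycStep-injectiveˡ : ∀ {n} {i j k : Fin n} → CycStep n i k → CycStep n j k → i ≡ j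
cycStep-injectiveˡ (inj₁ i+1≡k) (inj₁ j+1≡k) = toℕ-injective (ℕ.suc-injective (trans i+1≡k (sym j+1≡k)))
cycStep-injectiveˡ (inj₁ i+1≡k) (inj₂ (_ , k≡0)) with () ← trans i+1≡k k≡0
cycStep-injectiveˡ (inj₂ (_ , k≡0)) (inj₁ j+1≡k) with () ← trans j+1≡k k≡0
cycStep-injectiveˡ (inj₂ (i+1≡n , _)) (inj₂ (j+1≡n , _)) = toℕ-injective (ℕ.suc-injective (trans i+1≡n (sym j+1≡n)))

module _ {n : ℕ} .{{_ : NonZero n}} where

  cycle-twoSteps : ∀ {i j k : Fin n} → Adj (Cycle n) i j → Adj (Cycle n) j k →
                   (CycStep n i j × CycStep n j k) ⊎ (CycStep n k j × CycStep n j i) ⊎ i ≡ k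
  cycle-twoSteps (inj₁ i→j) (inj₁ j→k) = inj₁ (i→j , j→k)
  cycle-twoSteps (inj₂ j→i) (inj₂ k→j) = inj₂ (inj₁ (k→j , j→i))
  cycle-twoSteps (inj₁ i→j) (inj₂ k→j) = inj₂ (inj₂ (cycStep-injectiveˡ i→j k→j))
  cycle-twoSteps (inj₂ j→i) (inj₁ j→k) =
    inj₂ (inj₂ (trans (cycStep⇒≡cycleSucc j→i) (sym (cycStep⇒≡cycleSucc j→k))))

  reduce-step : ∀ {M} .{{_ : NonZero M}} → n ∣ M → ∀ {i i′ : Fin M} → CycStep M i i′ →
                toℕ i′ mod n ≡ cycleSucc (toℕ i mod n)
  reduce-step {M} n∣M {i} {i′} i→i′ = begin
    toℕ i′ mod n                  ≡⟨ cong (λ j → toℕ j mod n) (cycStep⇒≡cycleSucc i→i′) ⟩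
    toℕ (cycleSucc i) mod n       ≡⟨ mod-cong (trans (cong (_% n) (toℕ-mod _)) (m∣n⇒o%n%m≡o%m n M _ n∣M)) ⟩
    suc (toℕ i) mod n             ≡⟨ sym (cycleSucc-mod (toℕ i)) ⟩
    cycleSucc (toℕ i mod n)       ∎
    where open ≡-Reasoning

  -- −1 − m is congruent to n − 1 − m, which is what opposite computes.
  wrap : ℤ → Fin n
  wrap (+ m)    = m mod n
  wrap -[1+ m ] = opposite (m mod n)

  wrap-suc : ∀ z → CycStep n (wrap z) (wrap (sucℤ z))
  wrap-suc (+ m)        = subst (CycStep n (m mod n)) (cycleSucc-mod m) (cycStep-cycleSucc (m mod n))
  wrap-suc -[1+ zero ]  = inj₂ (last≡n , toℕ-0mod)
    where
    open ≡-Reasoning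
    last≡n : suc (toℕ (opposite (0 mod n))) ≡ n
    last≡n = begin
      suc (toℕ (opposite (0 mod n)))    ≡⟨ cong suc (opposite-prop (0 mod n)) ⟩
      suc (n ℕ.∸ suc (toℕ (0 mod n)))   ≡⟨ cong (λ r → suc (n ℕ.∸ suc r)) toℕ-0mod ⟩
      suc (n ℕ.∸ 1)                     ≡⟨ ℕ.suc-pred n ⟩
      n                                 ∎
  wrap-suc -[1+ suc m ] = cycStep-opposite (wrap-suc (+ m))

  wrap-period : wrap (+ n) ≡ wrap 0ℤ
  wrap-period = toℕ-injective (trans (toℕ-mod n) (trans (n%n≡0 n) (sym toℕ-0mod)))

-- L(1,1)-labellings of the square grid

module _ {A : Set} where

  Separates : (ℤ → ℤ → A) → ℤ → ℤ → Set
  Separates f dx dy = ∀ a b → f a b ≢ f (a + dx) (b + dy)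

  -- Up to exchanging the two points, these are all pairs at distance 1 or 2 in ℤ².
  record IsGridL11 (f : ℤ → ℤ → A) : Set where
    field
      east      : Separates f 1ℤ 0ℤ
      north     : Separates f 0ℤ 1ℤ
      east²     : Separates f (+ 2) 0ℤ
      north²    : Separates f 0ℤ (+ 2)
      northeast : Separates f 1ℤ 1ℤ
      southeast : Separates f 1ℤ -1ℤ

  translate : (ℤ → ℤ → A) → ℤ → ℤ → ℤ → ℤ → A
  translate f a₀ b₀ a b = f (a + a₀) (b + b₀)

  transpose : (ℤ → ℤ → A) → ℤ → ℤ → A
  transpose f a b = f b a

  translate-separates : ∀ {f dx dy} a₀ b₀ → Separates f dx dy → Separates (translate f a₀ b₀) dx dy
  translate-separates {f} {dx} {dy} a₀ b₀ sep a b =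
    subst₂ (λ a′ b′ → f (a + a₀) (b + b₀) ≢ f a′ b′)
      (xy∙z≈xz∙y a a₀ dx) (xy∙z≈xz∙y b b₀ dy) (sep (a + a₀) (b + b₀))

  translate-L11 : ∀ {f} → IsGridL11 f → ∀ a₀ b₀ → IsGridL11 (translate f a₀ b₀)
  translate-L11 P a₀ b₀ = record
    { east      = translate-separates a₀ b₀ east
    ; north     = translate-separates a₀ b₀ north
    ; east²     = translate-separates a₀ b₀ east²
    ; north²    = translate-separates a₀ b₀ north²
    ; northeast = translate-separates a₀ b₀ northeast
    ; southeast = translate-separates a₀ b₀ southeast
    }
    where open IsGridL11 P

  fromOrigin : ∀ {R : A → A → Set} dx dy →
               (∀ g → IsGridL11 g → R (g 0ℤ 0ℤ) (g dx dy)) →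
               ∀ f → IsGridL11 f → ∀ a b → R (f a b) (f (a + dx) (b + dy))
  fromOrigin {R} dx dy atOrigin f P a b =
    subst₂ (λ u v → R (f u v) (f (a + dx) (b + dy))) (+-identityˡ a) (+-identityˡ b)
      (subst₂ (λ u v → R (f (0ℤ + a) (0ℤ + b)) (f u v)) (+-comm dx a) (+-comm dy b)
        (atOrigin (translate f a b) (translate-L11 P a b)))

  separatesFromOrigin : ∀ dx dy → (∀ g → IsGridL11 g → g 0ℤ 0ℤ ≢ g dx dy) →
                        ∀ f → IsGridL11 f → Separates f dx dy
  separatesFromOrigin = fromOrigin {R = _≢_}

  transpose-L11 : ∀ {f} → IsGridL11 f → IsGridL11 (transpose f)
  transpose-L11 {f} P = record
    { east      = λ a b → north b a
    ; north     = λ a b → east b a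
    ; east²     = λ a b → north² b a
    ; north²    = λ a b → east² b a
    ; northeast = λ a b → northeast b a
    ; southeast = λ a b → northwest b a
    }
    where
    open IsGridL11 P
    northwest : Separates f -1ℤ 1ℤ
    northwest = separatesFromOrigin -1ℤ 1ℤ (λ g Q → ≢-sym (IsGridL11.southeast Q -1ℤ 1ℤ)) f P

unique⇒∈ : ∀ {n} {xs : Vec (Fin n) n} → Unique xs → ∀ c → c ∈ xs
unique⇒∈ {n} {xs} xs! c with any? (c ≟_) xs
... | yes c∈xs = c∈xs
... | no c∉xs = contradiction (injective⇒≤ (lookup-injective (∉⇒All≢ xs c∉xs ∷ xs!) _ _)) ℕ.1+n≰n
  where
  ∉⇒All≢ : ∀ {m} (ys : Vec (Fin n) m) → ¬ c ∈ ys → All (c ≢_) ys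
  ∉⇒All≢ []       _    = []
  ∉⇒All≢ (y ∷ ys) c∉ys = (c∉ys ∘ here) ∷ ∉⇒All≢ ys (c∉ys ∘ there)

closedNbhd : {A : Set} → (ℤ → ℤ → A) → Vec A 5
closedNbhd f = f 0ℤ 0ℤ ∷ f 1ℤ 0ℤ ∷ f -1ℤ 0ℤ ∷ f 0ℤ 1ℤ ∷ f 0ℤ -1ℤ ∷ []

pattern atCentre e = here e
pattern atEast e   = there (here e)
pattern atWest e   = there (there (here e))
pattern atNorth e  = there (there (there (here e)))
pattern atSouth e  = there (there (there (there (here e))))

closedNbhd-unique : {A : Set} {f : ℤ → ℤ → A} → IsGridL11 f → Unique (closedNbhd f)
closedNbhd-unique P =
    (east 0ℤ 0ℤ ∷ ≢-sym (east -1ℤ 0ℤ) ∷ north 0ℤ 0ℤ ∷ ≢-sym (north 0ℤ -1ℤ) ∷ [])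
  ∷ (≢-sym (east² -1ℤ 0ℤ) ∷ ≢-sym (southeast 0ℤ 1ℤ) ∷ ≢-sym (northeast 0ℤ -1ℤ) ∷ [])
  ∷ (northeast -1ℤ 0ℤ ∷ southeast -1ℤ 0ℤ ∷ [])
  ∷ (≢-sym (north² 0ℤ -1ℤ) ∷ [])
  ∷ []
  ∷ []
  where open IsGridL11 P

-- With five labels every closed neighbourhood is rainbow, so it contains every label.
covers : ∀ {f : ℤ → ℤ → Fin 5} → IsGridL11 f → ∀ a b c → c ∈ closedNbhd (translate f a b)
covers P a b = unique⇒∈ (closedNbhd-unique (translate-L11 P a b))

conflict : {A : Set} {c x y : A} → c ≡ x → c ≡ y → x ≢ y → ⊥
conflict c≡x c≡y x≢y = x≢y (trans (sym c≡x) c≡y)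

module _ (g : ℤ → ℤ → Fin 5) (P : IsGridL11 g) where
  open IsGridL11 P

  private
    c : Fin 5
    c = g 0ℤ 0ℤ

  -- Each proof lets the label c of the origin recur at the given point, locates c in
  -- a closed neighbourhood and excludes every position; notAtXY excludes that c also
  -- sits at (X, Y), with m marking a minus sign.
  east³₀ : g 0ℤ 0ℤ ≢ g (+ 3) 0ℤ
  east³₀ c≡g30 with covers P 1ℤ 1ℤ c
  ... | atCentre e = northeast 0ℤ 0ℤ e
  ... | atEast e   = conflict c≡g30 e (≢-sym (southeast (+ 2) 1ℤ))
  ... | atWest e   = north 0ℤ 0ℤ e
  ... | atNorth e  = notAt12 e (covers P (+ 2) 1ℤ c)
    where
    notAt12 : c ≡ g 1ℤ (+ 2) → c ∈ closedNbhd (translate g (+ 2) 1ℤ) → ⊥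
    notAt12 _ (atCentre e) = conflict c≡g30 e (≢-sym (southeast (+ 2) 1ℤ))
    notAt12 _ (atEast e)   = conflict c≡g30 e (north (+ 3) 0ℤ)
    notAt12 _ (atWest e)   = northeast 0ℤ 0ℤ e
    notAt12 c≡g12 (atNorth e) = conflict c≡g12 e (east 1ℤ (+ 2))
    notAt12 _ (atSouth e)  = conflict c≡g30 e (≢-sym (east (+ 2) 0ℤ))
  ... | atSouth e  = east 0ℤ 0ℤ e

  east⁴₀ : g 0ℤ 0ℤ ≢ g (+ 4) 0ℤ
  east⁴₀ c≡g40 with covers P (+ 2) 0ℤ c
  ... | atCentre e = east² 0ℤ 0ℤ e
  ... | atEast e   = conflict c≡g40 e (≢-sym (east (+ 3) 0ℤ))
  ... | atWest e   = east 0ℤ 0ℤ e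
  ... | atNorth e  = notAt21 e (covers P 1ℤ -1ℤ c)
    where
    notAt1m2 : c ≡ g (+ 2) 1ℤ → c ≡ g 1ℤ (- + 2) → c ∈ closedNbhd (translate g (+ 3) -1ℤ) → ⊥
    notAt1m2 _ _ (atCentre e)     = conflict c≡g40 e (≢-sym (northeast (+ 3) -1ℤ))
    notAt1m2 _ _ (atEast e)       = conflict c≡g40 e (≢-sym (north (+ 4) -1ℤ))
    notAt1m2 c≡g21 _ (atWest e)   = conflict c≡g21 e (≢-sym (north² (+ 2) -1ℤ))
    notAt1m2 _ _ (atNorth e)      = conflict c≡g40 e (≢-sym (east (+ 3) 0ℤ))
    notAt1m2 _ c≡g1m2 (atSouth e) = conflict c≡g1m2 e (east² 1ℤ (- + 2))
    notAt21 : c ≡ g (+ 2) 1ℤ → c ∈ closedNbhd (translate g 1ℤ -1ℤ) → ⊥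
    notAt21 _ (atCentre e)     = southeast 0ℤ 0ℤ e
    notAt21 c≡g21 (atEast e)   = conflict c≡g21 e (≢-sym (north² (+ 2) -1ℤ))
    notAt21 _ (atWest e)       = ≢-sym (north 0ℤ -1ℤ) e
    notAt21 _ (atNorth e)      = east 0ℤ 0ℤ e
    notAt21 c≡g21 (atSouth e)  = notAt1m2 c≡g21 e (covers P (+ 3) -1ℤ c)
  ... | atSouth e  = notAt2m1 e (covers P 1ℤ 1ℤ c)
    where
    notAt12 : c ≡ g (+ 2) -1ℤ → c ≡ g 1ℤ (+ 2) → c ∈ closedNbhd (translate g (+ 3) 1ℤ) → ⊥
    notAt12 _ _ (atCentre e)      = conflict c≡g40 e (≢-sym (southeast (+ 3) 1ℤ))
    notAt12 _ _ (atEast e)        = conflict c≡g40 e (north (+ 4) 0ℤ)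
    notAt12 c≡g2m1 _ (atWest e)   = conflict c≡g2m1 e (north² (+ 2) -1ℤ)
    notAt12 _ c≡g12 (atNorth e)   = conflict c≡g12 e (east² 1ℤ (+ 2))
    notAt12 _ _ (atSouth e)       = conflict c≡g40 e (≢-sym (east (+ 3) 0ℤ))
    notAt2m1 : c ≡ g (+ 2) -1ℤ → c ∈ closedNbhd (translate g 1ℤ 1ℤ) → ⊥
    notAt2m1 _ (atCentre e)      = northeast 0ℤ 0ℤ e
    notAt2m1 c≡g2m1 (atEast e)   = conflict c≡g2m1 e (north² (+ 2) -1ℤ)
    notAt2m1 _ (atWest e)        = north 0ℤ 0ℤ e
    notAt2m1 c≡g2m1 (atNorth e)  = notAt12 c≡g2m1 e (covers P (+ 3) 1ℤ c)
    notAt2m1 _ (atSouth e)       = east 0ℤ 0ℤ e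

  southeast²₀ : g 0ℤ 0ℤ ≢ g (+ 2) (- + 2)
  southeast²₀ c≡g2m2 with covers P 1ℤ -1ℤ c
  ... | atCentre e = southeast 0ℤ 0ℤ e
  ... | atEast e   = conflict c≡g2m2 e (north (+ 2) (- + 2))
  ... | atWest e   = ≢-sym (north 0ℤ -1ℤ) e
  ... | atNorth e  = east 0ℤ 0ℤ e
  ... | atSouth e  = conflict c≡g2m2 e (≢-sym (east 1ℤ (- + 2)))

module _ {f : ℤ → ℤ → Fin 5} (P : IsGridL11 f) where
  open IsGridL11 P

  east³ : Separates f (+ 3) 0ℤ
  east³ = separatesFromOrigin (+ 3) 0ℤ east³₀ f P

  east⁴ : Separates f (+ 4) 0ℤ
  east⁴ = separatesFromOrigin (+ 4) 0ℤ east⁴₀ f P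

  southeast² : Separates f (+ 2) (- + 2)
  southeast² = separatesFromOrigin (+ 2) (- + 2) southeast²₀ f P

-- Five consecutive labels of a row are pairwise distinct, so the sixth repeats the first.
east⁵₀ : ∀ g → IsGridL11 g → g (+ 5) 0ℤ ≡ g 0ℤ 0ℤ
east⁵₀ g P with unique⇒∈ rowUnique (g (+ 5) 0ℤ)
  where
  open IsGridL11 P
  rowUnique : Unique (g 0ℤ 0ℤ ∷ g 1ℤ 0ℤ ∷ g (+ 2) 0ℤ ∷ g (+ 3) 0ℤ ∷ g (+ 4) 0ℤ ∷ [])
  rowUnique =
      (east 0ℤ 0ℤ ∷ east² 0ℤ 0ℤ ∷ east³ P 0ℤ 0ℤ ∷ east⁴ P 0ℤ 0ℤ ∷ [])
    ∷ (east 1ℤ 0ℤ ∷ east² 1ℤ 0ℤ ∷ east³ P 1ℤ 0ℤ ∷ [])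
    ∷ (east (+ 2) 0ℤ ∷ east² (+ 2) 0ℤ ∷ [])
    ∷ (east (+ 3) 0ℤ ∷ [])
    ∷ []
    ∷ []
... | here e                                 = e
... | there (here e)                         = contradiction (sym e) (east⁴ P 1ℤ 0ℤ)
... | there (there (here e))                 = contradiction (sym e) (east³ P (+ 2) 0ℤ)
... | there (there (there (here e)))         = contradiction (sym e) (IsGridL11.east² P (+ 3) 0ℤ)
... | there (there (there (there (here e)))) = contradiction (sym e) (IsGridL11.east P (+ 4) 0ℤ)

east⁵ : ∀ {f} → IsGridL11 f → ∀ a b → f (a + + 5) (b + 0ℤ) ≡ f a b
east⁵ {f} = fromOrigin {R = λ x y → y ≡ x} (+ 5) 0ℤ east⁵₀ f

north⁵ : ∀ {f} → IsGridL11 f → ∀ a b → f (a + 0ℤ) (b + + 5) ≡ f a b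
north⁵ P a b = east⁵ (transpose-L11 P) b a

antidiagonal⁵₀ : ∀ g → IsGridL11 g → g (+ 5) (- + 5) ≡ g 0ℤ 0ℤ
antidiagonal⁵₀ g P = trans (east⁵ P 0ℤ (- + 5)) (sym (north⁵ P 0ℤ (- + 5)))

module Antidiagonal {f : ℤ → ℤ → Fin 5} (P : IsGridL11 f) where
  open IsGridL11 P

  antidiagonal : ℕ → Fin 5
  antidiagonal t = f (+ t) (- + t)

  antidiagonal-5+ : ∀ t → antidiagonal (5 ℕ.+ t) ≡ antidiagonal t
  antidiagonal-5+ t = begin
    f (+ (5 ℕ.+ t)) (- + (5 ℕ.+ t))   ≡⟨ cong (λ s → f (+ s) (- + s)) (ℕ.+-comm 5 t) ⟩
    f (+ t + + 5) (- (+ t + + 5))     ≡⟨ cong (f (+ t + + 5)) (neg-distrib-+ (+ t) (+ 5)) ⟩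
    f (+ t + + 5) (- + t + - + 5)     ≡⟨ fromOrigin {R = λ x y → y ≡ x} (+ 5) (- + 5) antidiagonal⁵₀ f P (+ t) (- + t) ⟩
    f (+ t) (- + t)                   ∎
    where open ≡-Reasoning

  antidiagonal-mod5 : ∀ t → antidiagonal t ≡ antidiagonal (t % 5)
  antidiagonal-mod5 t = begin
    antidiagonal t                            ≡⟨ cong antidiagonal (m≡m%n+[m/n]*n t 5) ⟩
    antidiagonal (t % 5 ℕ.+ t ℕ./ 5 ℕ.* 5)    ≡⟨ cong antidiagonal (ℕ.+-comm (t % 5) _) ⟩
    antidiagonal (t ℕ./ 5 ℕ.* 5 ℕ.+ t % 5)    ≡⟨ periodic (t ℕ./ 5) (t % 5) ⟩
    antidiagonal (t % 5)                      ∎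
    where
    open ≡-Reasoning
    periodic : ∀ q r → antidiagonal (q ℕ.* 5 ℕ.+ r) ≡ antidiagonal r
    periodic zero    r = refl
    periodic (suc q) r = trans (antidiagonal-5+ (q ℕ.* 5 ℕ.+ r)) (periodic q r)

  antidiagonal-return : ∀ h → antidiagonal h ≡ antidiagonal 0 → h % 5 ≡ 0
  antidiagonal-return h same = belowFive (h % 5) (m%n<n h 5) (trans (sym (antidiagonal-mod5 h)) same)
    where
    belowFive : ∀ r → r ℕ.< 5 → antidiagonal r ≡ antidiagonal 0 → r ≡ 0
    belowFive 0 _ _ = refl
    belowFive 1 _ e = contradiction (sym e) (southeast 0ℤ 0ℤ)
    belowFive 2 _ e = contradiction (sym e) (southeast² P 0ℤ 0ℤ)
    belowFive 3 _ e = contradiction (trans e (sym (antidiagonal-5+ 0))) (southeast² P (+ 3) (- + 3))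
    belowFive 4 _ e = contradiction (trans e (sym (antidiagonal-5+ 0))) (southeast (+ 4) (- + 4))
    belowFive (suc (suc (suc (suc (suc _))))) (s≤s (s≤s (s≤s (s≤s (s≤s ()))))) _

-- Lower bound

module _ {M N : ℕ} .{{_ : NonZero M}} .{{_ : NonZero N}} (3≤M : 3 ≤ M) (3≤N : 3 ≤ N) where

  private
    Torus : Graph
    Torus = Cycle M ×ᴳ Cycle N

  toTorus : ℤ → ℤ → V Torus
  toTorus a b = wrap (a + b) , wrap (a - b)

  module _ (l : V Torus → Fin 5) (valid : ∀ u v → Dist12 Torus u v → l u ≢ l v) where

    private
      ι : ℤ → ℤ → V Torus
      ι x y = wrap x , wrap y

      sucℤ² : ℤ → ℤ
      sucℤ² = sucℤ ∘ sucℤ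

      adj : ∀ x y → Adj Torus (ι x y) (ι (sucℤ x) (sucℤ y))
      adj x y = inj₁ (wrap-suc x) , inj₁ (wrap-suc y)

      adj′ : ∀ x y → Adj Torus (ι x (sucℤ y)) (ι (sucℤ x) y)
      adj′ x y = inj₁ (wrap-suc x) , inj₂ (wrap-suc y)

      ≢₁ : ∀ {u v : V Torus} → proj₁ u ≢ proj₁ v → u ≢ v
      ≢₁ u₁≢v₁ = u₁≢v₁ ∘ cong proj₁

      ≢₂ : ∀ {u v : V Torus} → proj₂ u ≢ proj₂ v → u ≢ v
      ≢₂ u₂≢v₂ = u₂≢v₂ ∘ cong proj₂

      wrap-≢-suc : ∀ x → wrap {M} x ≢ wrap (sucℤ x)
      wrap-≢-suc x = cycStep-irrefl (ℕ.<-trans (s≤s (s≤s z≤n)) 3≤M) (wrap-suc x)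

      wrap-≢-suc² : ∀ {n} .{{_ : NonZero n}} → 3 ≤ n → ∀ x → wrap {n} x ≢ wrap (sucℤ² x)
      wrap-≢-suc² 3≤n x = cycStep²-irrefl 3≤n (wrap-suc x) (wrap-suc (sucℤ x))

    -- The images of the six grid displacements under (a, b) ↦ (a + b, a − b).
    east-move : ∀ x y → l (ι x y) ≢ l (ι (sucℤ x) (sucℤ y))
    east-move x y = valid _ _ (≢₁ (wrap-≢-suc x) , inj₁ (adj x y))

    north-move : ∀ x y → l (ι x (sucℤ y)) ≢ l (ι (sucℤ x) y)
    north-move x y = valid _ _ (≢₁ (wrap-≢-suc x) , inj₁ (adj′ x y))

    east²-move : ∀ x y → l (ι x y) ≢ l (ι (sucℤ² x) (sucℤ² y))
    east²-move x y = valid _ _ (≢₁ (wrap-≢-suc² 3≤M x) , inj₂ (_ , adj x y , adj (sucℤ x) (sucℤ y)))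

    north²-move : ∀ x y → l (ι x (sucℤ² y)) ≢ l (ι (sucℤ² x) y)
    north²-move x y = valid _ _ (≢₁ (wrap-≢-suc² 3≤M x) , inj₂ (_ , adj′ x (sucℤ y) , adj′ (sucℤ x) y))

    northeast-move : ∀ x y → l (ι x y) ≢ l (ι (sucℤ² x) y)
    northeast-move x y = valid _ _ (≢₁ (wrap-≢-suc² 3≤M x) , inj₂ (_ , adj x y , adj′ (sucℤ x) y))

    southeast-move : ∀ x y → l (ι x y) ≢ l (ι x (sucℤ² y))
    southeast-move x y =
      valid _ _ (≢₂ (wrap-≢-suc² 3≤N y) , inj₂ (_ , adj x y , (inj₂ (wrap-suc x) , inj₁ (wrap-suc (sucℤ y)))))

    private
      moved : ∀ {u v u′ v′} → l u ≢ l v → u ≡ u′ → v ≡ v′ → l u′ ≢ l v′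
      moved sep refl refl = sep

    pullback-L11 : IsGridL11 (λ a b → l (toTorus a b))
    pullback-L11 = record
      { east      = λ a b → moved (east-move (a + b) (a - b))
                                  refl (cong₂ ι (eastˣ a b) (eastʸ a b))
      ; north     = λ a b → moved (north-move (a + b) (a + 0ℤ - (b + 1ℤ)))
                                  (cong (ι (a + b)) (northʸ a b)) (cong (λ x → ι x (a + 0ℤ - (b + 1ℤ))) (northˣ a b))
      ; east²     = λ a b → moved (east²-move (a + b) (a - b))
                                  refl (cong₂ ι (east²ˣ a b) (east²ʸ a b))
      ; north²    = λ a b → moved (north²-move (a + b) (a + 0ℤ - (b + + 2)))
                                  (cong (ι (a + b)) (north²ʸ a b)) (cong (λ x → ι x (a + 0ℤ - (b + + 2))) (north²ˣ a b))
      ; northeast = λ a b → moved (northeast-move (a + b) (a - b))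
                                  refl (cong₂ ι (northeastˣ a b) (northeastʸ a b))
      ; southeast = λ a b → moved (southeast-move (a + b) (a - b))
                                  refl (cong₂ ι (southeastˣ a b) (southeastʸ a b))
      }
      where
      eastˣ : ∀ a b → 1ℤ + (a + b) ≡ a + 1ℤ + (b + 0ℤ)
      eastˣ = solve-∀
      eastʸ : ∀ a b → 1ℤ + (a - b) ≡ a + 1ℤ - (b + 0ℤ)
      eastʸ = solve-∀
      northʸ : ∀ a b → 1ℤ + (a + 0ℤ - (b + 1ℤ)) ≡ a - b
      northʸ = solve-∀
      northˣ : ∀ a b → 1ℤ + (a + b) ≡ a + 0ℤ + (b + 1ℤ)
      northˣ = solve-∀
      east²ˣ : ∀ a b → 1ℤ + (1ℤ + (a + b)) ≡ a + + 2 + (b + 0ℤ)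
      east²ˣ = solve-∀
      east²ʸ : ∀ a b → 1ℤ + (1ℤ + (a - b)) ≡ a + + 2 - (b + 0ℤ)
      east²ʸ = solve-∀
      north²ʸ : ∀ a b → 1ℤ + (1ℤ + (a + 0ℤ - (b + + 2))) ≡ a - b
      north²ʸ = solve-∀
      north²ˣ : ∀ a b → 1ℤ + (1ℤ + (a + b)) ≡ a + 0ℤ + (b + + 2)
      north²ˣ = solve-∀
      northeastˣ : ∀ a b → 1ℤ + (1ℤ + (a + b)) ≡ a + 1ℤ + (b + 1ℤ)
      northeastˣ = solve-∀
      northeastʸ : ∀ a b → a - b ≡ a + 1ℤ - (b + 1ℤ)
      northeastʸ = solve-∀
      southeastˣ : ∀ a b → a + b ≡ a + 1ℤ + (b + -1ℤ)
      southeastˣ = solve-∀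
      southeastʸ : ∀ a b → 1ℤ + (1ℤ + (a - b)) ≡ a + 1ℤ - (b + -1ℤ)
      southeastʸ = solve-∀

    no-5-labelling : ∀ h → N ≡ h ℕ.+ h → h % 5 ≢ 0 → ⊥
    no-5-labelling h N≡2h h%5≢0 = h%5≢0 (antidiagonal-return h (cong l origin))
      where
      open Antidiagonal pullback-L11
      origin : toTorus (+ h) (- + h) ≡ toTorus 0ℤ 0ℤ
      origin = cong₂ _,_ (cong wrap (+-inverseʳ (+ h)))
        (begin
          wrap (+ h + - - + h)  ≡⟨ cong (λ z → wrap (+ h + z)) (neg-involutive (+ h)) ⟩
          wrap (+ (h ℕ.+ h))    ≡⟨ cong (wrap ∘ +_) (sym N≡2h) ⟩
          wrap (+ N)            ≡⟨ wrap-period ⟩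
          wrap 0ℤ               ∎)
        where open ≡-Reasoning

  λ₁₁≥5 : ∀ h → N ≡ h ℕ.+ h → h % 5 ≢ 0 → ∀ q → q < 5 → ¬ HasL11 (Cycle M ×ᴳ Cycle N) q
  λ₁₁≥5 h N≡2h h%5≢0 q q<5 (l , valid) = no-5-labelling l′ valid′ h N≡2h h%5≢0
    where
    l′ : V Torus → Fin 5
    l′ u = inject≤ (l u) q<5
    valid′ : ∀ u v → Dist12 Torus u v → l′ u ≢ l′ v
    valid′ u v d = valid u v d ∘ inject≤-injective q<5 q<5 (l u) (l v)

-- Upper bound

-- The label of (i, j) is T (φ i) (ρ j), where φ reduces the column modulo p and ρ gives
-- the state of row j; next s lists the states that may follow s.
module TableLabelling {p q : ℕ} .{{_ : NonZero p}} {S : Set}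
                      (T : Fin p → S → Fin (suc q)) (next : S → List S) where

  private
    _⁺ _⁺⁺ : Fin p → Fin p
    a ⁺  = cycleSucc a
    a ⁺⁺ = cycleSucc (cycleSucc a)

  AdjacentRowsOK : Fin p → S → S → Set
  AdjacentRowsOK a s s′ = T a s ≢ T (a ⁺) s′ × T (a ⁺) s ≢ T a s′

  SecondRowsOK : Fin p → S → S → Set
  SecondRowsOK a s s″ = T a s ≢ T (a ⁺⁺) s″ × T (a ⁺⁺) s ≢ T a s″ × T a s ≢ T a s″

  LocallyValid : Fin p → S → Set
  LocallyValid a s = T a s ≢ T (a ⁺⁺) s
                   × List.All (λ s′ → AdjacentRowsOK a s s′ × List.All (SecondRowsOK a s) (next s′)) (next s)

  locallyValid? : ∀ a s → Dec (LocallyValid a s)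
  locallyValid? a s = ¬? (T a s ≟ T (a ⁺⁺) s) ×-dec List.all? (λ s′ → adjacent? s′ ×-dec List.all? second? (next s′)) (next s)
    where
    adjacent? : ∀ s′ → Dec (AdjacentRowsOK a s s′)
    adjacent? s′ = ¬? (T a s ≟ T (a ⁺) s′) ×-dec ¬? (T (a ⁺) s ≟ T a s′)
    second? : ∀ s″ → Dec (SecondRowsOK a s s″)
    second? s″ = ¬? (T a s ≟ T (a ⁺⁺) s″) ×-dec ¬? (T (a ⁺⁺) s ≟ T a s″) ×-dec ¬? (T a s ≟ T a s″)

  module _ {M N : ℕ} .{{_ : NonZero M}} .{{_ : NonZero N}} (φ : Fin M → Fin p) (ρ : Fin N → S) where

    private
      G : Graph
      G = Cycle M ×ᴳ Cycle N

    label : V G → Fin (suc q)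
    label (i , j) = T (φ i) (ρ j)

    module _ (φ-step : ∀ {i i′} → CycStep M i i′ → φ i′ ≡ φ i ⁺)
             (ρ-step : ∀ {j j′} → CycStep N j j′ → ρ j′ ∈ₗ next (ρ j))
             (valid : ∀ a s → LocallyValid a s) where

      private
        adjacentOK : ∀ a {s s′} → s′ ∈ₗ next s → AdjacentRowsOK a s s′
        adjacentOK a s′∈ = proj₁ (List.lookup (proj₂ (valid a _)) s′∈)

        secondOK : ∀ a {s s′ s″} → s′ ∈ₗ next s → s″ ∈ₗ next s′ → SecondRowsOK a s s″
        secondOK a s′∈ s″∈ = List.lookup (proj₂ (List.lookup (proj₂ (valid a _)) s′∈)) s″∈

        T-congˡ : ∀ {a b} s → a ≡ b → T a s ≡ T b s
        T-congˡ s = cong (λ a → T a s)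

        rowsForward-adjacent : ∀ {i i′ j j′} → Adj (Cycle M) i i′ → ρ j′ ∈ₗ next (ρ j) → label (i , j) ≢ label (i′ , j′)
        rowsForward-adjacent {i} (inj₁ i→i′) r same =
          proj₁ (adjacentOK (φ i) r) (trans same (T-congˡ _ (φ-step i→i′)))
        rowsForward-adjacent {i} {i′} (inj₂ i′→i) r same =
          proj₂ (adjacentOK (φ i′) r) (trans (T-congˡ _ (sym (φ-step i′→i))) same)

        adjacent : ∀ {u v} → Adj G u v → label u ≢ label v
        adjacent (ci , inj₁ j→j′) = rowsForward-adjacent ci (ρ-step j→j′)
        adjacent (inj₁ c , inj₂ j′→j) = ≢-sym (rowsForward-adjacent (inj₂ c) (ρ-step j′→j))
        adjacent (inj₂ c , inj₂ j′→j) = ≢-sym (rowsForward-adjacent (inj₁ c) (ρ-step j′→j))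

        ColumnsTwoApart : Fin M → Fin M → Set
        ColumnsTwoApart i i′ = φ i′ ≡ φ i ⁺⁺ ⊎ φ i ≡ φ i′ ⁺⁺ ⊎ i ≡ i′

        swapColumns : ∀ {i i′} → ColumnsTwoApart i i′ → ColumnsTwoApart i′ i
        swapColumns (inj₁ e)        = inj₂ (inj₁ e)
        swapColumns (inj₂ (inj₁ e)) = inj₁ e
        swapColumns (inj₂ (inj₂ e)) = inj₂ (inj₂ (sym e))

        columnsTwoApart : ∀ {i w i′} → Adj (Cycle M) i w → Adj (Cycle M) w i′ → ColumnsTwoApart i i′
        columnsTwoApart ci₁ ci₂ with cycle-twoSteps ci₁ ci₂
        ... | inj₁ (i→w , w→i′)        = inj₁ (trans (φ-step w→i′) (cong _⁺ (φ-step i→w)))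
        ... | inj₂ (inj₁ (i′→w , w→i)) = inj₂ (inj₁ (trans (φ-step w→i) (cong _⁺ (φ-step i′→w))))
        ... | inj₂ (inj₂ i≡i′)         = inj₂ (inj₂ i≡i′)

        rowsForward-twoApart : ∀ {i i′ j j″ s′} → ColumnsTwoApart i i′ →
                               s′ ∈ₗ next (ρ j) → ρ j″ ∈ₗ next s′ → label (i , j) ≢ label (i′ , j″)
        rowsForward-twoApart {i} (inj₁ e) r₁ r₂ same =
          proj₁ (secondOK (φ i) r₁ r₂) (trans same (T-congˡ _ e))
        rowsForward-twoApart {i} {i′} (inj₂ (inj₁ e)) r₁ r₂ same =
          proj₁ (proj₂ (secondOK (φ i′) r₁ r₂)) (trans (T-congˡ _ (sym e)) same)
        rowsForward-twoApart {i} (inj₂ (inj₂ refl)) r₁ r₂ same =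
          proj₂ (proj₂ (secondOK (φ i) r₁ r₂)) same

        sameRow-twoApart : ∀ {i i′ j} → φ i′ ≡ φ i ⁺⁺ → label (i , j) ≢ label (i′ , j)
        sameRow-twoApart {i} {j = j} e same = proj₁ (valid (φ i) (ρ j)) (trans same (T-congˡ _ e))

        twoApart : ∀ {u w v} → u ≢ v → Adj G u w → Adj G w v → label u ≢ label v
        twoApart u≢v (ci₁ , cj₁) (ci₂ , cj₂) with columnsTwoApart ci₁ ci₂ | cycle-twoSteps cj₁ cj₂
        ... | cols | inj₁ (j→w , w→j′) = rowsForward-twoApart cols (ρ-step j→w) (ρ-step w→j′)
        ... | cols | inj₂ (inj₁ (j′→w , w→j)) =
          ≢-sym (rowsForward-twoApart (swapColumns cols) (ρ-step j′→w) (ρ-step w→j))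
        ... | inj₁ e           | inj₂ (inj₂ refl) = sameRow-twoApart e
        ... | inj₂ (inj₁ e)    | inj₂ (inj₂ refl) = ≢-sym (sameRow-twoApart e)
        ... | inj₂ (inj₂ refl) | inj₂ (inj₂ refl) = contradiction refl u≢v

      label-L11 : IsL11Labeling (Cycle M ×ᴳ Cycle N) q label
      label-L11 u v (_   , inj₁ u~v)             = adjacent u~v
      label-L11 u v (u≢v , inj₂ (_ , u~w , w~v)) = twoApart u≢v u~w w~v

-- The rows of C_(k + ℓ n) run through a tail of k states once and then n times
-- around a loop of ℓ states.
module Lollipop (k₀ ℓ₀ : ℕ) where

  private
    k ℓ : ℕ
    k = suc k₀
    ℓ = suc ℓ₀

  State : Set
  State = Fin k ⊎ Fin ℓ

  private
    crossTo : ∀ {n} {A : Set} → Fin (suc n) → A → List A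
    crossTo Fin.zero    x = x ∷ []
    crossTo (Fin.suc _) _ = []

  -- After the last state of the tail or of the loop the word may continue with
  -- the first state of either.
  next : State → List State
  next (inj₁ i) = inj₁ (cycleSucc i) ∷ crossTo (cycleSucc i) (inj₂ Fin.zero)
  next (inj₂ r) = inj₂ (cycleSucc r) ∷ crossTo (cycleSucc r) (inj₁ Fin.zero)

  rowState : ℕ → State
  rowState t with t ℕ.<? k
  ... | yes _ = inj₁ (t mod k)
  ... | no  _ = inj₂ ((t ℕ.∸ k) mod ℓ)

  rowState-tail : ∀ {t} → t < k → rowState t ≡ inj₁ (t mod k)
  rowState-tail {t} t<k with t ℕ.<? k
  ... | yes _  = refl
  ... | no t≮k = contradiction t<k t≮k

  rowState-loop : ∀ {t} → k ≤ t → rowState t ≡ inj₂ ((t ℕ.∸ k) mod ℓ)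
  rowState-loop {t} k≤t with t ℕ.<? k
  ... | yes t<k = contradiction k≤t (ℕ.<⇒≱ t<k)
  ... | no _    = refl

  next-crossˡ : ∀ {i} → cycleSucc i ≡ Fin.zero → inj₂ Fin.zero ∈ₗ next (inj₁ i)
  next-crossˡ e rewrite e = there (here refl)

  next-crossʳ : ∀ {r} → cycleSucc r ≡ Fin.zero → inj₁ Fin.zero ∈ₗ next (inj₂ r)
  next-crossʳ e rewrite e = there (here refl)

  rowState-suc : ∀ t → rowState (suc t) ∈ₗ next (rowState t)
  rowState-suc t with ℕ.<-cmp (suc t) k
  ... | tri< t+1<k _ _ = subst₂ (λ x s → x ∈ₗ next s)
          (sym (rowState-tail t+1<k)) (sym (rowState-tail (ℕ.<-trans (ℕ.n<1+n t) t+1<k)))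
          (here (cong inj₁ (sym (cycleSucc-mod t))))
  ... | tri≈ _ t+1≡k _ = subst₂ (λ x s → x ∈ₗ next s)
          (sym (trans (rowState-loop (ℕ.≤-reflexive (sym t+1≡k)))
                      (cong (λ m → inj₂ (m mod ℓ)) (ℕ.m≤n⇒m∸n≡0 (ℕ.≤-reflexive t+1≡k)))))
          (sym (rowState-tail (ℕ.≤-reflexive t+1≡k)))
          (next-crossˡ (cycleSucc-mod≡zero (∣-reflexive (sym t+1≡k))))
  ... | tri> _ _ k<t+1 = subst₂ (λ x s → x ∈ₗ next s)
          (sym (trans (rowState-loop (ℕ.<⇒≤ k<t+1))
                      (cong (λ m → inj₂ (m mod ℓ)) (ℕ.+-∸-assoc 1 (ℕ.s≤s⁻¹ k<t+1)))))
          (sym (rowState-loop (ℕ.s≤s⁻¹ k<t+1)))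
          (here (cong inj₂ (sym (cycleSucc-mod (t ℕ.∸ k)))))

  rowState-last : ∀ n t → suc t ≡ k ℕ.+ ℓ ℕ.* n → rowState 0 ∈ₗ next (rowState t)
  rowState-last n t t+1≡N with t ℕ.<? k
  ... | yes t<k = here (cong inj₁ (sym (cycleSucc-mod≡zero (∣-reflexive (sym t+1≡k)))))
    where
    t+1≡k : suc t ≡ k
    t+1≡k = ℕ.≤-antisym t<k (subst (k ≤_) (sym t+1≡N) (ℕ.m≤m+n k (ℓ ℕ.* n)))
  ... | no t≮k = next-crossʳ (cycleSucc-mod≡zero (subst (ℓ ∣_) (sym t∸k+1≡ℓn) (m∣m*n n)))
    where
    t∸k+1≡ℓn : suc (t ℕ.∸ k) ≡ ℓ ℕ.* n
    t∸k+1≡ℓn = begin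
      suc (t ℕ.∸ k)          ≡⟨ sym (ℕ.+-∸-assoc 1 (ℕ.≮⇒≥ t≮k)) ⟩
      suc t ℕ.∸ k            ≡⟨ cong (ℕ._∸ k) t+1≡N ⟩
      k ℕ.+ ℓ ℕ.* n ℕ.∸ k    ≡⟨ ℕ.m+n∸m≡n k (ℓ ℕ.* n) ⟩
      ℓ ℕ.* n                ∎
      where open ≡-Reasoning

  rowState-step : ∀ n {j j′ : Fin (k ℕ.+ ℓ ℕ.* n)} → CycStep (k ℕ.+ ℓ ℕ.* n) j j′ →
                  rowState (toℕ j′) ∈ₗ next (rowState (toℕ j))
  rowState-step n {j} (inj₁ j+1≡j′) =
    subst (λ t → rowState t ∈ₗ next (rowState (toℕ j))) j+1≡j′ (rowState-suc (toℕ j))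
  rowState-step n {j} (inj₂ (j+1≡N , j′≡0)) =
    subst (λ t → rowState t ∈ₗ next (rowState (toℕ j))) (sym j′≡0) (rowState-last n (toℕ j) j+1≡N)

-- Repeated on its own, the loop labels C_10m × C_10n with the five labels 0–4; the
-- blocks of k rows below need the sixth label 5.
loop : Vec (Vec (Fin 6) 10) 10
loop =
    (# 0 ∷ # 0 ∷ # 3 ∷ # 3 ∷ # 1 ∷ # 1 ∷ # 4 ∷ # 4 ∷ # 2 ∷ # 2 ∷ [])
  ∷ (# 3 ∷ # 1 ∷ # 1 ∷ # 4 ∷ # 4 ∷ # 2 ∷ # 2 ∷ # 0 ∷ # 0 ∷ # 3 ∷ [])
  ∷ (# 4 ∷ # 4 ∷ # 2 ∷ # 2 ∷ # 0 ∷ # 0 ∷ # 3 ∷ # 3 ∷ # 1 ∷ # 1 ∷ [])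
  ∷ (# 2 ∷ # 0 ∷ # 0 ∷ # 3 ∷ # 3 ∷ # 1 ∷ # 1 ∷ # 4 ∷ # 4 ∷ # 2 ∷ [])
  ∷ (# 3 ∷ # 3 ∷ # 1 ∷ # 1 ∷ # 4 ∷ # 4 ∷ # 2 ∷ # 2 ∷ # 0 ∷ # 0 ∷ [])
  ∷ (# 1 ∷ # 4 ∷ # 4 ∷ # 2 ∷ # 2 ∷ # 0 ∷ # 0 ∷ # 3 ∷ # 3 ∷ # 1 ∷ [])
  ∷ (# 2 ∷ # 2 ∷ # 0 ∷ # 0 ∷ # 3 ∷ # 3 ∷ # 1 ∷ # 1 ∷ # 4 ∷ # 4 ∷ [])
  ∷ (# 0 ∷ # 3 ∷ # 3 ∷ # 1 ∷ # 1 ∷ # 4 ∷ # 4 ∷ # 2 ∷ # 2 ∷ # 0 ∷ [])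
  ∷ (# 1 ∷ # 1 ∷ # 4 ∷ # 4 ∷ # 2 ∷ # 2 ∷ # 0 ∷ # 0 ∷ # 3 ∷ # 3 ∷ [])
  ∷ (# 4 ∷ # 2 ∷ # 2 ∷ # 0 ∷ # 0 ∷ # 3 ∷ # 3 ∷ # 1 ∷ # 1 ∷ # 4 ∷ [])
  ∷ []

module RowPattern {k₀ : ℕ} (tail : Vec (Vec (Fin 6) 10) (suc k₀)) where

  open Lollipop k₀ 9

  table : Fin 10 → State → Fin 6
  table a (inj₁ i) = lookup (lookup tail i) a
  table a (inj₂ r) = lookup (lookup loop r) a

  open TableLabelling table next

  Valid : Set
  Valid = ∀ a s → LocallyValid a s

  valid? : Dec Valid
  valid? = Fin.all? λ a → Dec.map′ (λ (onTail , onLoop) → [ onTail , onLoop ]) (λ h → h ∘ inj₁ , h ∘ inj₂)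
             (Fin.all? (locallyValid? a ∘ inj₁) ×-dec Fin.all? (locallyValid? a ∘ inj₂))

  λ₁₁≤5 : Valid → ∀ m n → HasL11 (Cycle (10 ℕ.* suc m) ×ᴳ Cycle (suc k₀ ℕ.+ 10 ℕ.* n)) 5
  λ₁₁≤5 valid m n = label φ ρ , label-L11 φ ρ (reduce-step (m∣m*n (suc m))) (rowState-step n) valid
    where
    φ : Fin (10 ℕ.* suc m) → Fin 10
    φ i = toℕ i mod 10
    ρ : Fin (suc k₀ ℕ.+ 10 ℕ.* n) → State
    ρ j = rowState (toℕ j)

tail₁₂ : Vec (Vec (Fin 6) 10) 12
tail₁₂ =
    (# 0 ∷ # 0 ∷ # 3 ∷ # 3 ∷ # 1 ∷ # 1 ∷ # 4 ∷ # 4 ∷ # 2 ∷ # 2 ∷ [])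
  ∷ (# 3 ∷ # 1 ∷ # 5 ∷ # 5 ∷ # 4 ∷ # 2 ∷ # 2 ∷ # 0 ∷ # 5 ∷ # 5 ∷ [])
  ∷ (# 4 ∷ # 4 ∷ # 2 ∷ # 2 ∷ # 0 ∷ # 5 ∷ # 5 ∷ # 0 ∷ # 3 ∷ # 1 ∷ [])
  ∷ (# 0 ∷ # 3 ∷ # 1 ∷ # 4 ∷ # 0 ∷ # 3 ∷ # 3 ∷ # 1 ∷ # 4 ∷ # 2 ∷ [])
  ∷ (# 1 ∷ # 5 ∷ # 5 ∷ # 3 ∷ # 1 ∷ # 4 ∷ # 2 ∷ # 2 ∷ # 0 ∷ # 3 ∷ [])
  ∷ (# 2 ∷ # 0 ∷ # 4 ∷ # 2 ∷ # 2 ∷ # 0 ∷ # 1 ∷ # 4 ∷ # 5 ∷ # 5 ∷ [])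
  ∷ (# 2 ∷ # 0 ∷ # 3 ∷ # 1 ∷ # 4 ∷ # 5 ∷ # 5 ∷ # 0 ∷ # 3 ∷ # 4 ∷ [])
  ∷ (# 1 ∷ # 4 ∷ # 5 ∷ # 5 ∷ # 0 ∷ # 3 ∷ # 4 ∷ # 2 ∷ # 3 ∷ # 1 ∷ [])
  ∷ (# 5 ∷ # 2 ∷ # 0 ∷ # 4 ∷ # 2 ∷ # 3 ∷ # 1 ∷ # 1 ∷ # 4 ∷ # 5 ∷ [])
  ∷ (# 0 ∷ # 3 ∷ # 3 ∷ # 1 ∷ # 1 ∷ # 4 ∷ # 5 ∷ # 5 ∷ # 2 ∷ # 0 ∷ [])
  ∷ (# 1 ∷ # 1 ∷ # 4 ∷ # 5 ∷ # 5 ∷ # 2 ∷ # 0 ∷ # 0 ∷ # 3 ∷ # 3 ∷ [])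
  ∷ (# 4 ∷ # 2 ∷ # 2 ∷ # 0 ∷ # 0 ∷ # 3 ∷ # 3 ∷ # 1 ∷ # 1 ∷ # 4 ∷ [])
  ∷ []

tail₁₄ : Vec (Vec (Fin 6) 10) 14
tail₁₄ =
    (# 0 ∷ # 0 ∷ # 3 ∷ # 3 ∷ # 1 ∷ # 1 ∷ # 4 ∷ # 4 ∷ # 2 ∷ # 2 ∷ [])
  ∷ (# 3 ∷ # 1 ∷ # 5 ∷ # 5 ∷ # 4 ∷ # 2 ∷ # 2 ∷ # 0 ∷ # 5 ∷ # 5 ∷ [])
  ∷ (# 4 ∷ # 4 ∷ # 2 ∷ # 2 ∷ # 0 ∷ # 5 ∷ # 5 ∷ # 0 ∷ # 1 ∷ # 1 ∷ [])
  ∷ (# 2 ∷ # 0 ∷ # 0 ∷ # 4 ∷ # 3 ∷ # 3 ∷ # 1 ∷ # 4 ∷ # 4 ∷ # 3 ∷ [])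
  ∷ (# 5 ∷ # 5 ∷ # 3 ∷ # 1 ∷ # 1 ∷ # 4 ∷ # 2 ∷ # 2 ∷ # 0 ∷ # 3 ∷ [])
  ∷ (# 1 ∷ # 1 ∷ # 4 ∷ # 2 ∷ # 2 ∷ # 0 ∷ # 5 ∷ # 5 ∷ # 0 ∷ # 2 ∷ [])
  ∷ (# 4 ∷ # 2 ∷ # 0 ∷ # 3 ∷ # 5 ∷ # 0 ∷ # 3 ∷ # 1 ∷ # 1 ∷ # 4 ∷ [])
  ∷ (# 3 ∷ # 5 ∷ # 0 ∷ # 3 ∷ # 1 ∷ # 1 ∷ # 4 ∷ # 4 ∷ # 2 ∷ # 0 ∷ [])
  ∷ (# 3 ∷ # 5 ∷ # 1 ∷ # 4 ∷ # 4 ∷ # 2 ∷ # 0 ∷ # 3 ∷ # 5 ∷ # 0 ∷ [])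
  ∷ (# 1 ∷ # 4 ∷ # 2 ∷ # 0 ∷ # 3 ∷ # 2 ∷ # 0 ∷ # 3 ∷ # 5 ∷ # 1 ∷ [])
  ∷ (# 0 ∷ # 3 ∷ # 5 ∷ # 0 ∷ # 3 ∷ # 5 ∷ # 1 ∷ # 1 ∷ # 2 ∷ # 4 ∷ [])
  ∷ (# 0 ∷ # 3 ∷ # 5 ∷ # 1 ∷ # 1 ∷ # 4 ∷ # 4 ∷ # 0 ∷ # 2 ∷ # 5 ∷ [])
  ∷ (# 1 ∷ # 1 ∷ # 4 ∷ # 4 ∷ # 2 ∷ # 2 ∷ # 5 ∷ # 0 ∷ # 3 ∷ # 5 ∷ [])
  ∷ (# 4 ∷ # 2 ∷ # 2 ∷ # 0 ∷ # 0 ∷ # 3 ∷ # 3 ∷ # 1 ∷ # 1 ∷ # 4 ∷ [])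
  ∷ []

tail₁₆ : Vec (Vec (Fin 6) 10) 16
tail₁₆ =
    (# 0 ∷ # 0 ∷ # 3 ∷ # 3 ∷ # 1 ∷ # 1 ∷ # 4 ∷ # 4 ∷ # 2 ∷ # 2 ∷ [])
  ∷ (# 3 ∷ # 1 ∷ # 5 ∷ # 5 ∷ # 4 ∷ # 2 ∷ # 2 ∷ # 0 ∷ # 5 ∷ # 5 ∷ [])
  ∷ (# 4 ∷ # 4 ∷ # 2 ∷ # 2 ∷ # 0 ∷ # 5 ∷ # 5 ∷ # 0 ∷ # 1 ∷ # 1 ∷ [])
  ∷ (# 2 ∷ # 0 ∷ # 0 ∷ # 4 ∷ # 3 ∷ # 3 ∷ # 1 ∷ # 4 ∷ # 4 ∷ # 3 ∷ [])
  ∷ (# 5 ∷ # 5 ∷ # 3 ∷ # 1 ∷ # 1 ∷ # 4 ∷ # 2 ∷ # 2 ∷ # 0 ∷ # 3 ∷ [])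
  ∷ (# 1 ∷ # 1 ∷ # 4 ∷ # 2 ∷ # 2 ∷ # 0 ∷ # 5 ∷ # 5 ∷ # 0 ∷ # 2 ∷ [])
  ∷ (# 4 ∷ # 2 ∷ # 0 ∷ # 3 ∷ # 5 ∷ # 0 ∷ # 4 ∷ # 1 ∷ # 1 ∷ # 4 ∷ [])
  ∷ (# 3 ∷ # 5 ∷ # 5 ∷ # 4 ∷ # 1 ∷ # 1 ∷ # 4 ∷ # 3 ∷ # 2 ∷ # 0 ∷ [])
  ∷ (# 3 ∷ # 1 ∷ # 2 ∷ # 4 ∷ # 3 ∷ # 2 ∷ # 2 ∷ # 3 ∷ # 5 ∷ # 5 ∷ [])
  ∷ (# 4 ∷ # 1 ∷ # 0 ∷ # 0 ∷ # 3 ∷ # 5 ∷ # 5 ∷ # 4 ∷ # 1 ∷ # 2 ∷ [])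
  ∷ (# 0 ∷ # 3 ∷ # 5 ∷ # 5 ∷ # 4 ∷ # 1 ∷ # 0 ∷ # 4 ∷ # 1 ∷ # 0 ∷ [])
  ∷ (# 5 ∷ # 4 ∷ # 1 ∷ # 2 ∷ # 2 ∷ # 1 ∷ # 0 ∷ # 3 ∷ # 3 ∷ # 5 ∷ [])
  ∷ (# 2 ∷ # 2 ∷ # 1 ∷ # 0 ∷ # 3 ∷ # 3 ∷ # 5 ∷ # 5 ∷ # 4 ∷ # 1 ∷ [])
  ∷ (# 0 ∷ # 3 ∷ # 3 ∷ # 5 ∷ # 5 ∷ # 4 ∷ # 4 ∷ # 2 ∷ # 2 ∷ # 0 ∷ [])
  ∷ (# 5 ∷ # 5 ∷ # 4 ∷ # 4 ∷ # 2 ∷ # 2 ∷ # 0 ∷ # 0 ∷ # 3 ∷ # 3 ∷ [])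
  ∷ (# 4 ∷ # 2 ∷ # 2 ∷ # 0 ∷ # 0 ∷ # 3 ∷ # 3 ∷ # 1 ∷ # 1 ∷ # 4 ∷ [])
  ∷ []

tail₁₈ : Vec (Vec (Fin 6) 10) 18
tail₁₈ =
    (# 0 ∷ # 0 ∷ # 3 ∷ # 3 ∷ # 1 ∷ # 1 ∷ # 4 ∷ # 4 ∷ # 2 ∷ # 2 ∷ [])
  ∷ (# 3 ∷ # 1 ∷ # 5 ∷ # 5 ∷ # 4 ∷ # 2 ∷ # 2 ∷ # 0 ∷ # 5 ∷ # 5 ∷ [])
  ∷ (# 4 ∷ # 4 ∷ # 2 ∷ # 2 ∷ # 0 ∷ # 5 ∷ # 5 ∷ # 0 ∷ # 1 ∷ # 1 ∷ [])
  ∷ (# 2 ∷ # 0 ∷ # 0 ∷ # 4 ∷ # 3 ∷ # 3 ∷ # 1 ∷ # 4 ∷ # 4 ∷ # 3 ∷ [])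
  ∷ (# 5 ∷ # 5 ∷ # 3 ∷ # 1 ∷ # 1 ∷ # 4 ∷ # 2 ∷ # 2 ∷ # 0 ∷ # 3 ∷ [])
  ∷ (# 1 ∷ # 1 ∷ # 4 ∷ # 2 ∷ # 2 ∷ # 0 ∷ # 5 ∷ # 5 ∷ # 0 ∷ # 2 ∷ [])
  ∷ (# 4 ∷ # 2 ∷ # 0 ∷ # 3 ∷ # 5 ∷ # 0 ∷ # 3 ∷ # 1 ∷ # 1 ∷ # 4 ∷ [])
  ∷ (# 3 ∷ # 5 ∷ # 5 ∷ # 3 ∷ # 1 ∷ # 1 ∷ # 4 ∷ # 4 ∷ # 2 ∷ # 0 ∷ [])
  ∷ (# 3 ∷ # 1 ∷ # 1 ∷ # 4 ∷ # 4 ∷ # 2 ∷ # 0 ∷ # 3 ∷ # 5 ∷ # 5 ∷ [])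
  ∷ (# 4 ∷ # 4 ∷ # 2 ∷ # 0 ∷ # 3 ∷ # 2 ∷ # 5 ∷ # 3 ∷ # 0 ∷ # 1 ∷ [])
  ∷ (# 0 ∷ # 3 ∷ # 2 ∷ # 5 ∷ # 3 ∷ # 0 ∷ # 1 ∷ # 4 ∷ # 4 ∷ # 2 ∷ [])
  ∷ (# 5 ∷ # 3 ∷ # 0 ∷ # 5 ∷ # 1 ∷ # 4 ∷ # 2 ∷ # 0 ∷ # 1 ∷ # 2 ∷ [])
  ∷ (# 5 ∷ # 1 ∷ # 4 ∷ # 4 ∷ # 0 ∷ # 3 ∷ # 2 ∷ # 5 ∷ # 3 ∷ # 0 ∷ [])
  ∷ (# 4 ∷ # 0 ∷ # 2 ∷ # 2 ∷ # 5 ∷ # 3 ∷ # 0 ∷ # 5 ∷ # 3 ∷ # 1 ∷ [])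
  ∷ (# 2 ∷ # 5 ∷ # 3 ∷ # 0 ∷ # 5 ∷ # 2 ∷ # 1 ∷ # 1 ∷ # 4 ∷ # 2 ∷ [])
  ∷ (# 0 ∷ # 5 ∷ # 3 ∷ # 1 ∷ # 1 ∷ # 4 ∷ # 4 ∷ # 2 ∷ # 5 ∷ # 3 ∷ [])
  ∷ (# 1 ∷ # 1 ∷ # 4 ∷ # 4 ∷ # 2 ∷ # 5 ∷ # 0 ∷ # 0 ∷ # 5 ∷ # 3 ∷ [])
  ∷ (# 4 ∷ # 2 ∷ # 2 ∷ # 0 ∷ # 0 ∷ # 3 ∷ # 3 ∷ # 1 ∷ # 1 ∷ # 4 ∷ [])
  ∷ []

tail₁₂-valid : RowPattern.Valid tail₁₂
tail₁₂-valid = Dec.toWitness {a? = RowPattern.valid? tail₁₂} _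

tail₁₄-valid : RowPattern.Valid tail₁₄
tail₁₄-valid = Dec.toWitness {a? = RowPattern.valid? tail₁₄} _

tail₁₆-valid : RowPattern.Valid tail₁₆
tail₁₆-valid = Dec.toWitness {a? = RowPattern.valid? tail₁₆} _

tail₁₈-valid : RowPattern.Valid tail₁₈
tail₁₈-valid = Dec.toWitness {a? = RowPattern.valid? tail₁₈} _

λ₁₁≡5 : ∀ {k₀} (tail : Vec (Vec (Fin 6) 10) (suc k₀)) → RowPattern.Valid tail →
        ∀ h → suc k₀ ≡ h ℕ.+ h → h % 5 ≢ 0 → 3 ≤ suc k₀ →
        ∀ m n → λ11≡ (Cycle (10 ℕ.* suc m) ×ᴳ Cycle (suc k₀ ℕ.+ 10 ℕ.* n)) 5
λ₁₁≡5 {k₀} tail valid h k≡2h h%5≢0 3≤k m n =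
    RowPattern.λ₁₁≤5 tail valid m n
  , λ₁₁≥5 3≤M 3≤N (h ℕ.+ n ℕ.* 5) N≡2h′ h′%5≢0
  where
  3≤M : 3 ≤ 10 ℕ.* suc m
  3≤M = ℕ.≤-trans (s≤s (s≤s (s≤s z≤n))) (ℕ.m≤m*n 10 (suc m))
  3≤N : 3 ≤ suc k₀ ℕ.+ 10 ℕ.* n
  3≤N = ℕ.≤-trans 3≤k (ℕ.m≤m+n (suc k₀) _)
  regroup : ∀ h n → h ℕ.+ h ℕ.+ 10 ℕ.* n ≡ (h ℕ.+ n ℕ.* 5) ℕ.+ (h ℕ.+ n ℕ.* 5)
  regroup = ℕ.solve-∀
  N≡2h′ : suc k₀ ℕ.+ 10 ℕ.* n ≡ (h ℕ.+ n ℕ.* 5) ℕ.+ (h ℕ.+ n ℕ.* 5)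
  N≡2h′ = trans (cong (ℕ._+ 10 ℕ.* n) k≡2h) (regroup h n)
  h′%5≢0 : (h ℕ.+ n ℕ.* 5) % 5 ≢ 0
  h′%5≢0 = h%5≢0 ∘ trans (sym ([m+kn]%n≡m%n h n 5))

mainTheorem19 : ∀ (k m′ n′ : ℕ) → k ∈ₗ (12 ∷ 14 ∷ 16 ∷ 18 ∷ []) → 1 ≤ m′ →
    λ11≡ (Cycle (10 ℕ.* m′) ×ᴳ Cycle (k ℕ.+ 10 ℕ.* n′)) 5
mainTheorem19 _ (suc m) n (here refl) _ =
  λ₁₁≡5 tail₁₂ tail₁₂-valid 6 refl (λ ()) (s≤s (s≤s (s≤s z≤n))) m n
mainTheorem19 _ (suc m) n (there (here refl)) _ =
  λ₁₁≡5 tail₁₄ tail₁₄-valid 7 refl (λ ()) (s≤s (s≤s (s≤s z≤n))) m n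
mainTheorem19 _ (suc m) n (there (there (here refl))) _ =
  λ₁₁≡5 tail₁₆ tail₁₆-valid 8 refl (λ ()) (s≤s (s≤s (s≤s z≤n))) m n
mainTheorem19 _ (suc m) n (there (there (there (here refl)))) _ =
  λ₁₁≡5 tail₁₈ tail₁₈-valid 9 refl (λ ()) (s≤s (s≤s (s≤s z≤n))) m n
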